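{- Suppose that there exists an integer $\delta \geqslant 9$ such that $\theta(n) \leqslant \left(2^{2^{n-5}}-1\right)^{2^{n-5}}+1$ for every integer $n \geqslant \delta$. Then there exists an algorithm which takes as input a Diophantine equation $D(x_1,\ldots,x_p)=0$ (with $D \in \mathbb{Z}[x_1,\ldots,x_p]$) and returns "Yes" or "No", such that whenever the equation has only finitely many solutions in positive integers, the output correctly states whether the equation has a solution in positive integers.
   Context: For a positive integer $n$, let $E_n=\{x_i \cdot x_j=x_k,\ x_i+1=x_k:\ i,j,k \in \{1,\ldots,n\}\}$, a set of equations in the variables $x_1,\ldots,x_n$. Let $\theta(n)$ denote the smallest positive integer $b$ such that for each system $S \subseteq E_n$ which has a solution in positive integers $x_1,\ldots,x_n$ and which has only finitely many solutions in positive integers $x_1,\ldots,x_n$, there exists a solution of $S$ in $([1,b] \cap \mathbb{N})^n$. -}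

module Defs where

open import Data.Nat using (ℕ; _+_; _*_; _∸_; _^_; _≤_)
open import Data.Integer as ℤ using (ℤ)
open import Data.Fin using (Fin)
open import Data.Vec using (Vec; lookup)
open import Data.Vec.Relation.Unary.All using (All)
open import Data.List using (List)
open import Data.List.Membership.Propositional using (_∈_)
open import Data.List.Relation.Unary.All as LAll using ()
open import Data.Product using (Σ; _×_; ∃)
open import Relation.Binary.PropositionalEquality using (_≡_)

data Eqn (n : ℕ) : Set where
  mulEq : Fin n → Fin n → Fin n → Eqn n
  sucEq : Fin n → Fin n → Eqn n

System : ℕ → Set
System n = List (Eqn n)

Holds : ∀ {n} → Vec ℕ n → Eqn n → Set
Holds x (mulEq i j k) = lookup x i * lookup x j ≡ lookup x k
Holds x (sucEq i k)   = lookup x i + 1 ≡ lookup x k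

Positive : ∀ {n} → Vec ℕ n → Set
Positive = All (1 ≤_)

SolvesSys : ∀ {n} → System n → Vec ℕ n → Set
SolvesSys S x = Positive x × LAll.All (Holds x) S

FinitelyManySys : ∀ {n} → System n → Set
FinitelyManySys {n} S =
  ∃ λ (L : List (Vec ℕ n)) → ∀ x → SolvesSys S x → x ∈ L

ThetaProp : ℕ → ℕ → Set
ThetaProp n b =
  (S : System n) → (∃ λ x → SolvesSys S x) → FinitelyManySys S →
  ∃ λ x → SolvesSys S x × All (_≤ b) x

IsTheta : ℕ → ℕ → Set
IsTheta n b = 1 ≤ b × ThetaProp n b × (∀ c → 1 ≤ c → ThetaProp n c → b ≤ c)

ThetaLeq : ℕ → ℕ → Set
ThetaLeq n B = ∃ λ b → IsTheta n b × b ≤ B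

bound : ℕ → ℕ
bound n = ((2 ^ (2 ^ (n ∸ 5))) ∸ 1) ^ (2 ^ (n ∸ 5)) + 1

data Poly (p : ℕ) : Set where
  con  : ℤ → Poly p
  var  : Fin p → Poly p
  _⊕_  : Poly p → Poly p → Poly p
  _⊗_  : Poly p → Poly p → Poly p

eval : ∀ {p} → Poly p → Vec ℕ p → ℤ
eval (con c) x = c
eval (var i) x = ℤ.+ (lookup x i)
eval (d ⊕ e) x = eval d x ℤ.+ eval e x
eval (d ⊗ e) x = eval d x ℤ.* eval e x

SolvesD : ∀ {p} → Poly p → Vec ℕ p → Set
SolvesD D x = Positive x × eval D x ≡ ℤ.+ 0

FinitelyManyD : ∀ {p} → Poly p → Set
FinitelyManyD {p} D =
  ∃ λ (L : List (Vec ℕ p)) → ∀ x → SolvesD D x → x ∈ L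

{-# OPTIONS --safe #-}
module Submission where

-- The positive solutions of D(x) = 0 are simulated by a system S ⊆ E_N: every subterm t of D
-- is represented by two unknowns u, v with t = u − v (a sum or product of differences is again a
-- difference of sums and products), and x + y is expressed by products and successors alone
-- through (z x + 1)(z y + 1) = z²(x y + 1) + 1, which for positive z forces z = x + y.
-- Every unknown of S is then determined by x, so S has finitely many solutions when D = 0 has,
-- and padding makes N ≥ δ. Hence S has a solution bounded by θ(N) iff D = 0 is solvable, and the
-- finitely many candidates can be searched.

open import Defs
open import Data.Nat
  using (ℕ; _≤_; zero; suc; _+_; _*_; _∸_; _<_; z≤n; s≤s; s≤s⁻¹; z<s; _<?_; _≤?_; _≟_; _<ᵇ_)
open import Data.Nat.Properties
import Data.Nat.Tactic.RingSolver as ℕ-Ring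
open import Data.Bool using (Bool; true; T)
open import Data.Integer as ℤ using (ℤ; +_; -[1+_]; _⊖_)
import Data.Integer.Properties as ℤ
import Data.Integer.Tactic.RingSolver as ℤ-Ring
open import Data.Fin using (Fin; toℕ; fromℕ<)
import Data.Fin.Properties as Fin
open import Data.Vec using (Vec; []; _∷_; lookup; tabulate)
import Data.Vec.Properties as Vec
import Data.Vec.Relation.Unary.All as VecAll
open import Data.Vec.Relation.Unary.All using ([]; _∷_)
import Data.Vec.Relation.Unary.All.Properties as VecAll
open import Data.List using (List; []; _∷_; _++_; map; replicate)
import Data.List.Properties as List
open import Data.List.Relation.Unary.All as All using ([]; _∷_)
import Data.List.Relation.Unary.All.Properties as All
open import Data.List.Membership.Propositional using (_∈_)
open import Data.List.Membership.Propositional.Properties using (∈-map⁺)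
open import Data.Product using (Σ; ∃; _×_; _,_; proj₁; proj₂; map₁; map₂; swap)
open import Data.Unit using (⊤; tt)
open import Function using (_∘_)
open import Function.Bundles using (_⇔_; mk⇔)
import Function.Properties.Equivalence as ⇔
open import Relation.Nullary using (Dec; yes; no; does; contradiction)
import Relation.Nullary.Decidable as Dec
open import Relation.Nullary.Decidable using (_×-dec_)
open import Relation.Unary using (Decidable)
open import Relation.Binary.PropositionalEquality

-- Unknowns are indexed by ℕ (cells), so that a program can be generated before the number N of
-- unknowns is known; the translation to E_N comes last.
Assignment : Set
Assignment = ℕ → ℕ

data Equation : Set where
  mulE : ℕ → ℕ → ℕ → Equation
  sucE : ℕ → ℕ → Equation

infix 4 _⊨_ _⊨*_ _≈[_]_

_⊨_ : Assignment → Equation → Set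
ρ ⊨ mulE i j k = ρ i * ρ j ≡ ρ k
ρ ⊨ sucE i k   = ρ i + 1 ≡ ρ k

_⊨*_ : Assignment → List Equation → Set
ρ ⊨* es = All.All (ρ ⊨_) es

VarsBelow : ℕ → Equation → Set
VarsBelow n (mulE i j k) = i < n × j < n × k < n
VarsBelow n (sucE i k)   = i < n × k < n

_≈[_]_ : Assignment → ℕ → Assignment → Set
ρ ≈[ n ] σ = ∀ m → m < n → ρ m ≡ σ m

AllPositive : Assignment → Set
AllPositive ρ = ∀ m → 1 ≤ ρ m

VarsBelow-mono : ∀ {m n} → m ≤ n → ∀ {e} → VarsBelow m e → VarsBelow n e
VarsBelow-mono m≤n {mulE _ _ _} (i< , j< , k<) = <-≤-trans i< m≤n , <-≤-trans j< m≤n , <-≤-trans k< m≤n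
VarsBelow-mono m≤n {sucE _ _}   (i< , k<)       = <-≤-trans i< m≤n , <-≤-trans k< m≤n

⊨-resp-≈ : ∀ {ρ σ n} → ρ ≈[ n ] σ → ∀ {e} → VarsBelow n e → ρ ⊨ e → σ ⊨ e
⊨-resp-≈ ρ≈σ {mulE i j k} (i< , j< , k<) ρ⊨e =
  trans (sym (cong₂ _*_ (ρ≈σ i i<) (ρ≈σ j j<))) (trans ρ⊨e (ρ≈σ k k<))
⊨-resp-≈ ρ≈σ {sucE i k} (i< , k<) ρ⊨e =
  trans (sym (cong (_+ 1) (ρ≈σ i i<))) (trans ρ⊨e (ρ≈σ k k<))

⊨*-resp-≈ : ∀ {ρ σ n es} → ρ ≈[ n ] σ → All.All (VarsBelow n) es → ρ ⊨* es → σ ⊨* es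
⊨*-resp-≈ ρ≈σ below holds = All.zipWith (λ (b , h) → ⊨-resp-≈ ρ≈σ b h) (below , holds)

-- Straight-line programs

-- An instruction placed at cell c fills cells c, …, c + width − 1 (output x ρ t is the value of
-- cell t + c) from arguments below c.
data Instr : Set where
  oneI : Instr
  sucI : ℕ → Instr
  mulI : ℕ → ℕ → Instr
  addI : ℕ → ℕ → Instr

width : Instr → ℕ
width (addI _ _) = 10
width _          = 1

-- Cells c, …, c + 9 of addI i j hold z, z x, z x + 1, z y, z y + 1, (z x + 1)(z y + 1), z², x y,
-- x y + 1 and z²(x y + 1) for x = ρ i, y = ρ j; the last equation says
-- (z x + 1)(z y + 1) = z²(x y + 1) + 1, which for z ≥ 1 holds exactly when z = x + y.
instrEqs : Instr → ℕ → List Equation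
instrEqs oneI       c = mulE c c c ∷ []
instrEqs (sucI i)   c = sucE i c ∷ []
instrEqs (mulI i j) c = mulE i j c ∷ []
instrEqs (addI i j) c =
  mulE c i (1 + c) ∷ sucE (1 + c) (2 + c) ∷ mulE c j (3 + c) ∷ sucE (3 + c) (4 + c) ∷
  mulE (2 + c) (4 + c) (5 + c) ∷ mulE c c (6 + c) ∷ mulE i j (7 + c) ∷ sucE (7 + c) (8 + c) ∷
  mulE (6 + c) (8 + c) (9 + c) ∷ sucE (9 + c) (5 + c) ∷ []

ArgsBelow : Instr → ℕ → Set
ArgsBelow oneI       c = ⊤
ArgsBelow (sucI i)   c = i < c
ArgsBelow (mulI i j) c = i < c × j < c
ArgsBelow (addI i j) c = i < c × j < c

sumCells : ℕ → ℕ → ℕ → ℕ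
sumCells x y 0 = x + y
sumCells x y 1 = (x + y) * x
sumCells x y 2 = (x + y) * x + 1
sumCells x y 3 = (x + y) * y
sumCells x y 4 = (x + y) * y + 1
sumCells x y 5 = ((x + y) * x + 1) * ((x + y) * y + 1)
sumCells x y 6 = (x + y) * (x + y)
sumCells x y 7 = x * y
sumCells x y 8 = x * y + 1
sumCells x y 9 = (x + y) * (x + y) * (x * y + 1)
sumCells x y _ = 1

output : Instr → Assignment → ℕ → ℕ
output oneI       ρ _ = 1
output (sucI i)   ρ _ = ρ i + 1
output (mulI i j) ρ _ = ρ i * ρ j
output (addI i j) ρ t = sumCells (ρ i) (ρ j) t

sumCells-positive : ∀ {x y} → 1 ≤ x → 1 ≤ y → ∀ t → 1 ≤ sumCells x y t
sumCells-positive {x} {y} 1≤x 1≤y t = cell t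
  where
  inc : ∀ a → 1 ≤ a + 1
  inc a = m≤n+m 1 a
  mul : ∀ {a b} → 1 ≤ a → 1 ≤ b → 1 ≤ a * b
  mul = *-mono-≤
  1≤x+y : 1 ≤ x + y
  1≤x+y = ≤-trans 1≤x (m≤m+n x y)
  cell : ∀ t → 1 ≤ sumCells x y t
  cell 0 = 1≤x+y
  cell 1 = mul 1≤x+y 1≤x
  cell 2 = inc _
  cell 3 = mul 1≤x+y 1≤y
  cell 4 = inc _
  cell 5 = mul (inc ((x + y) * x)) (inc ((x + y) * y))
  cell 6 = mul 1≤x+y 1≤x+y
  cell 7 = mul 1≤x 1≤y
  cell 8 = inc _
  cell 9 = mul (mul 1≤x+y 1≤x+y) (inc _)
  cell (suc (suc (suc (suc (suc (suc (suc (suc (suc (suc _)))))))))) = s≤s z≤n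

output-positive : ∀ x {ρ} → AllPositive ρ → ∀ t → 1 ≤ output x ρ t
output-positive oneI       ρ⁺ t = s≤s z≤n
output-positive (sucI i)   ρ⁺ t = m≤n+m 1 _
output-positive (mulI i j) ρ⁺ t = *-mono-≤ (ρ⁺ i) (ρ⁺ j)
output-positive (addI i j) ρ⁺ t = sumCells-positive (ρ⁺ i) (ρ⁺ j) t

output-resp-≈ : ∀ x {ρ σ c} → ρ ≈[ c ] σ → ArgsBelow x c → ∀ t → output x ρ t ≡ output x σ t
output-resp-≈ oneI       ρ≈σ _         t = refl
output-resp-≈ (sucI i)   ρ≈σ i<        t = cong (_+ 1) (ρ≈σ i i<)
output-resp-≈ (mulI i j) ρ≈σ (i< , j<) t = cong₂ _*_ (ρ≈σ i i<) (ρ≈σ j j<)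
output-resp-≈ (addI i j) ρ≈σ (i< , j<) t = cong₂ (λ x y → sumCells x y t) (ρ≈σ i i<) (ρ≈σ j j<)

sum-gadget : ∀ x y → (x + y) * (x + y) * (x * y + 1) + 1 ≡ ((x + y) * x + 1) * ((x + y) * y + 1)
sum-gadget = ℕ-Ring.solve-∀

sum-gadget⁻¹ : ∀ z x y → 1 ≤ z → (z * x + 1) * (z * y + 1) ≡ z * z * (x * y + 1) + 1 → z ≡ x + y
sum-gadget⁻¹ z@(suc _) x y _ gadget =
  sym (*-cancelˡ-≡ (x + y) z z (+-cancelˡ-≡ (z * z * (x * y)) _ _ (+-cancelʳ-≡ 1 _ _ expanded)))
  where
  expandˡ : ∀ z x y → (z * x + 1) * (z * y + 1) ≡ z * z * (x * y) + z * (x + y) + 1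
  expandˡ = ℕ-Ring.solve-∀
  expandʳ : ∀ z x y → z * z * (x * y + 1) + 1 ≡ z * z * (x * y) + z * z + 1
  expandʳ = ℕ-Ring.solve-∀
  expanded : z * z * (x * y) + z * (x + y) + 1 ≡ z * z * (x * y) + z * z + 1
  expanded = trans (sym (expandˡ z x y)) (trans gadget (expandʳ z x y))

m*m≡m⇒m≡1 : ∀ m → 1 ≤ m → m * m ≡ m → m ≡ 1
m*m≡m⇒m≡1 m@(suc _) _ m*m≡m = *-cancelʳ-≡ m 1 m (trans m*m≡m (sym (+-identityʳ m)))

opaque
  assignFrom : ℕ → (ℕ → ℕ) → Assignment → Assignment
  assignFrom c f ρ m with m <? c
  ... | yes _ = ρ m
  ... | no  _ = f (m ∸ c)

  assignFrom-≈ : ∀ {c f ρ} → assignFrom c f ρ ≈[ c ] ρ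
  assignFrom-≈ {c} m m<c with m <? c
  ... | yes _   = refl
  ... | no  m≮c = contradiction m<c m≮c

  assignFrom-at : ∀ {c f ρ} t → assignFrom c f ρ (t + c) ≡ f t
  assignFrom-at {c} {f} t with t + c <? c
  ... | yes t+c<c = contradiction t+c<c (m+n≮n t c)
  ... | no  _     = cong f (m+n∸n≡m t c)

  assignFrom-positive : ∀ {c f ρ} → AllPositive ρ → (∀ t → 1 ≤ f t) → AllPositive (assignFrom c f ρ)
  assignFrom-positive {c} ρ⁺ f⁺ m with m <? c
  ... | yes _ = ρ⁺ m
  ... | no  _ = f⁺ (m ∸ c)

mulE-holds : ∀ {σ : Assignment} {a b d u v} → σ a ≡ u → σ b ≡ v → σ d ≡ u * v → σ ⊨ mulE a b d
mulE-holds σa σb σd = trans (cong₂ _*_ σa σb) (sym σd)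

sucE-holds : ∀ {σ : Assignment} {a d u} → σ a ≡ u → σ d ≡ u + 1 → σ ⊨ sucE a d
sucE-holds σa σd = trans (cong (_+ 1) σa) (sym σd)

assignFrom-⊨ : ∀ x {c} ρ → ArgsBelow x c → assignFrom c (output x ρ) ρ ⊨* instrEqs x c
assignFrom-⊨ oneI {c} ρ _ =
  mulE-holds {assignFrom c _ ρ} (assignFrom-at 0) (assignFrom-at 0) (assignFrom-at 0) ∷ []
assignFrom-⊨ (sucI i) {c} ρ i< =
  sucE-holds {assignFrom c _ ρ} (assignFrom-≈ _ i<) (assignFrom-at 0) ∷ []
assignFrom-⊨ (mulI i j) {c} ρ (i< , j<) =
  mulE-holds {assignFrom c _ ρ} (assignFrom-≈ _ i<) (assignFrom-≈ _ j<) (assignFrom-at 0) ∷ []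
assignFrom-⊨ (addI i j) {c} ρ (i< , j<) =
  mul (at 0) (old i<) (at 1) ∷ inc (at 1) (at 2) ∷ mul (at 0) (old j<) (at 3) ∷ inc (at 3) (at 4) ∷
  mul (at 2) (at 4) (at 5) ∷ mul (at 0) (at 0) (at 6) ∷ mul (old i<) (old j<) (at 7) ∷
  inc (at 7) (at 8) ∷ mul (at 6) (at 8) (at 9) ∷ inc (at 9) (trans (at 5) (sym (sum-gadget (ρ i) (ρ j)))) ∷ []
  where
  σ = assignFrom c (output (addI i j) ρ) ρ
  at : ∀ t → σ (t + c) ≡ sumCells (ρ i) (ρ j) t
  at = assignFrom-at
  old : ∀ {m} → m < c → σ m ≡ ρ m
  old = assignFrom-≈ _
  mul : ∀ {a b d u v} → σ a ≡ u → σ b ≡ v → σ d ≡ u * v → σ ⊨ mulE a b d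
  mul = mulE-holds {σ}
  inc : ∀ {a d u} → σ a ≡ u → σ d ≡ u + 1 → σ ⊨ sucE a d
  inc = sucE-holds {σ}

offset-< : ∀ t k c → {T (t <ᵇ k)} → t + c < k + c
offset-< t k c {t<k} = +-monoˡ-< c (<ᵇ⇒< t k t<k)

instrEqs-below : ∀ x {c} → ArgsBelow x c → All.All (VarsBelow (width x + c)) (instrEqs x c)
instrEqs-below oneI       {c} _         = (n<1+n c , n<1+n c , n<1+n c) ∷ []
instrEqs-below (sucI i)   {c} i<        = (m<n⇒m<1+n i< , n<1+n c) ∷ []
instrEqs-below (mulI i j) {c} (i< , j<) = (m<n⇒m<1+n i< , m<n⇒m<1+n j< , n<1+n c) ∷ []
instrEqs-below (addI i j) {c} (i< , j<) =
  (cell 0 , old i< , cell 1) ∷ (cell 1 , cell 2) ∷ (cell 0 , old j< , cell 3) ∷ (cell 3 , cell 4) ∷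
  (cell 2 , cell 4 , cell 5) ∷ (cell 0 , cell 0 , cell 6) ∷ (old i< , old j< , cell 7) ∷
  (cell 7 , cell 8) ∷ (cell 6 , cell 8 , cell 9) ∷ (cell 9 , cell 5) ∷ []
  where
  cell : ∀ t → {T (t <ᵇ 10)} → t + c < 10 + c
  cell t {t<10} = offset-< t 10 c {t<10}
  old : ∀ {m} → m < c → m < 10 + c
  old = m≤n⇒m≤o+n 10

sum-determined : ∀ {ρ i j c} → 1 ≤ ρ c → ρ ⊨* instrEqs (addI i j) c →
                 ∀ t → t < 10 → ρ (t + c) ≡ sumCells (ρ i) (ρ j) t
sum-determined {ρ} {i} {j} {c} 1≤z (e₁ ∷ e₂ ∷ e₃ ∷ e₄ ∷ e₅ ∷ e₆ ∷ e₇ ∷ e₈ ∷ e₉ ∷ e₁₀ ∷ []) = cell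
  where
  open ≡-Reasoning
  x = ρ i
  y = ρ j
  z = ρ c
  z≡x+y : z ≡ x + y
  z≡x+y = sum-gadget⁻¹ z x y 1≤z (begin
    (z * x + 1) * (z * y + 1)  ≡⟨ cong₂ _*_ (trans (cong (_+ 1) e₁) e₂) (trans (cong (_+ 1) e₃) e₄) ⟩
    ρ (2 + c) * ρ (4 + c)      ≡⟨ e₅ ⟩
    ρ (5 + c)                  ≡⟨ e₁₀ ⟨
    ρ (9 + c) + 1              ≡⟨ cong (_+ 1) e₉ ⟨
    ρ (6 + c) * ρ (8 + c) + 1  ≡⟨ cong (_+ 1) (cong₂ _*_ e₆ (trans (cong (_+ 1) e₇) e₈)) ⟨
    z * z * (x * y + 1) + 1    ∎)
  zx = trans (sym e₁) (cong (_* x) z≡x+y)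
  zx+1 = trans (sym e₂) (cong (_+ 1) zx)
  zy = trans (sym e₃) (cong (_* y) z≡x+y)
  zy+1 = trans (sym e₄) (cong (_+ 1) zy)
  z² = trans (sym e₆) (cong₂ _*_ z≡x+y z≡x+y)
  xy+1 = trans (sym e₈) (cong (_+ 1) (sym e₇))
  cell : ∀ t → t < 10 → ρ (t + c) ≡ sumCells x y t
  cell 0 _ = z≡x+y
  cell 1 _ = zx
  cell 2 _ = zx+1
  cell 3 _ = zy
  cell 4 _ = zy+1
  cell 5 _ = trans (sym e₅) (cong₂ _*_ zx+1 zy+1)
  cell 6 _ = z²
  cell 7 _ = sym e₇
  cell 8 _ = xy+1
  cell 9 _ = trans (sym e₉) (cong₂ _*_ z² xy+1)
  cell (suc (suc (suc (suc (suc (suc (suc (suc (suc (suc _)))))))))) t<10 = contradiction t<10 (m+n≮m 10 _)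

instr-determined : ∀ x {ρ c} → AllPositive ρ → ρ ⊨* instrEqs x c →
                   ∀ t → t < width x → ρ (t + c) ≡ output x ρ t
instr-determined oneI       ρ⁺ (e ∷ []) _ (s≤s z≤n) = m*m≡m⇒m≡1 _ (ρ⁺ _) e
instr-determined (sucI i)   ρ⁺ (e ∷ []) _ (s≤s z≤n) = sym e
instr-determined (mulI i j) ρ⁺ (e ∷ []) _ (s≤s z≤n) = sym e
instr-determined (addI i j) ρ⁺ es       t t<10      = sum-determined (ρ⁺ _) es t t<10

instrEqs-determine : ∀ x {c ρ σ} → AllPositive ρ → AllPositive σ → ArgsBelow x c →
                     ρ ⊨* instrEqs x c → σ ⊨* instrEqs x c → ρ ≈[ c ] σ → ρ ≈[ width x + c ] σ
instrEqs-determine x {c} {ρ} {σ} ρ⁺ σ⁺ args ρ⊨ σ⊨ ρ≈σ m m<top with m <? c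
... | yes m<c = ρ≈σ m m<c
... | no  m≮c = begin
  ρ m               ≡⟨ cong ρ t+c≡m ⟨
  ρ (t + c)         ≡⟨ instr-determined x ρ⁺ ρ⊨ t t<width ⟩
  output x ρ t      ≡⟨ output-resp-≈ x ρ≈σ args t ⟩
  output x σ t      ≡⟨ instr-determined x σ⁺ σ⊨ t t<width ⟨
  σ (t + c)         ≡⟨ cong σ t+c≡m ⟩
  σ m               ∎
  where
  open ≡-Reasoning
  t = m ∸ c
  t+c≡m : t + c ≡ m
  t+c≡m = m∸n+n≡m (≮⇒≥ m≮c)
  t<width : t < width x
  t<width = +-cancelʳ-< c t (width x) (subst (_< width x + c) (sym t+c≡m) m<top)

Program : Set
Program = List Instr

top : Program → ℕ → ℕ
top []      c = c
top (x ∷ P) c = top P (width x + c)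

progEqs : Program → ℕ → List Equation
progEqs []      c = []
progEqs (x ∷ P) c = instrEqs x c ++ progEqs P (width x + c)

WellScoped : Program → ℕ → Set
WellScoped []      c = ⊤
WellScoped (x ∷ P) c = ArgsBelow x c × WellScoped P (width x + c)

run : Program → ℕ → Assignment → Assignment
run []      c ρ = ρ
run (x ∷ P) c ρ = run P (width x + c) (assignFrom c (output x ρ) ρ)

c≤top : ∀ P c → c ≤ top P c
c≤top []      c = ≤-refl
c≤top (x ∷ P) c = ≤-trans (m≤n+m c (width x)) (c≤top P (width x + c))

top-++ : ∀ P Q c → top (P ++ Q) c ≡ top Q (top P c)
top-++ []      Q c = refl
top-++ (x ∷ P) Q c = top-++ P Q (width x + c)

progEqs-++ : ∀ P Q c → progEqs (P ++ Q) c ≡ progEqs P c ++ progEqs Q (top P c)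
progEqs-++ []      Q c = refl
progEqs-++ (x ∷ P) Q c =
  trans (cong (instrEqs x c ++_) (progEqs-++ P Q (width x + c))) (sym (List.++-assoc (instrEqs x c) _ _))

WellScoped-++ : ∀ P Q c → WellScoped P c → WellScoped Q (top P c) → WellScoped (P ++ Q) c
WellScoped-++ []      Q c _            wsQ = wsQ
WellScoped-++ (x ∷ P) Q c (args , wsP) wsQ = args , WellScoped-++ P Q (width x + c) wsP wsQ

⊨*-++⁻ : ∀ {ρ} P Q c → ρ ⊨* progEqs (P ++ Q) c → ρ ⊨* progEqs P c × ρ ⊨* progEqs Q (top P c)
⊨*-++⁻ P Q c ρ⊨ = All.++⁻ (progEqs P c) (subst (All.All _) (progEqs-++ P Q c) ρ⊨)

run-≈ : ∀ P c ρ → run P c ρ ≈[ c ] ρ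
run-≈ []      c ρ m m<c = refl
run-≈ (x ∷ P) c ρ m m<c =
  trans (run-≈ P (width x + c) _ m (<-≤-trans m<c (m≤n+m c (width x)))) (assignFrom-≈ m m<c)

run-positive : ∀ P c {ρ} → AllPositive ρ → AllPositive (run P c ρ)
run-positive []      c ρ⁺ = ρ⁺
run-positive (x ∷ P) c ρ⁺ = run-positive P (width x + c) (assignFrom-positive ρ⁺ (output-positive x ρ⁺))

progEqs-below : ∀ P c → WellScoped P c → All.All (VarsBelow (top P c)) (progEqs P c)
progEqs-below []      c _            = []
progEqs-below (x ∷ P) c (args , wsP) =
  All.++⁺ (All.map (VarsBelow-mono (c≤top P (width x + c))) (instrEqs-below x args))
          (progEqs-below P (width x + c) wsP)

run-⊨ : ∀ P c ρ → WellScoped P c → run P c ρ ⊨* progEqs P c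
run-⊨ []      c ρ _            = []
run-⊨ (x ∷ P) c ρ (args , wsP) =
  All.++⁺ (⊨*-resp-≈ (λ m m<c → sym (run-≈ P (width x + c) _ m m<c)) (instrEqs-below x args)
                     (assignFrom-⊨ x ρ args))
          (run-⊨ P (width x + c) _ wsP)

progEqs-determine : ∀ P c {ρ σ} → AllPositive ρ → AllPositive σ → WellScoped P c →
                    ρ ⊨* progEqs P c → σ ⊨* progEqs P c → ρ ≈[ c ] σ → ρ ≈[ top P c ] σ
progEqs-determine []      c ρ⁺ σ⁺ _            _  _  ρ≈σ = ρ≈σ
progEqs-determine (x ∷ P) c ρ⁺ σ⁺ (args , wsP) ρ⊨ σ⊨ ρ≈σ =
  progEqs-determine P (width x + c) ρ⁺ σ⁺ wsP (All.++⁻ʳ (instrEqs x c) ρ⊨) (All.++⁻ʳ (instrEqs x c) σ⊨)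
    (instrEqs-determine x ρ⁺ σ⁺ args (All.++⁻ˡ (instrEqs x c) ρ⊨) (All.++⁻ˡ (instrEqs x c) σ⊨) ρ≈σ)

-- Compiling polynomials

record Compiled : Set where
  constructor compiled
  field
    code : Program
    pos  : ℕ
    neg  : ℕ

open Compiled

Denotes : Assignment → Compiled → ℤ → Set
Denotes ρ r z = ρ (pos r) ⊖ ρ (neg r) ≡ z

WellFormed : Compiled → ℕ → Set
WellFormed r c = WellScoped (code r) c × pos r < top (code r) c × neg r < top (code r) c

Tail : Set
Tail = ℕ → ℕ → ℕ → ℕ → ℕ → Compiled

Implements : Tail → (ℤ → ℤ → ℤ) → Set
Implements tail _∙_ = ∀ {ρ a₁ b₁ a₂ b₂ c} → AllPositive ρ →
  ρ ⊨* progEqs (code (tail a₁ b₁ a₂ b₂ c)) c → Denotes ρ (tail a₁ b₁ a₂ b₂ c) ((ρ a₁ ⊖ ρ b₁) ∙ (ρ a₂ ⊖ ρ b₂))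

ScopedTail : Tail → Set
ScopedTail tail = ∀ {a₁ b₁ a₂ b₂ c} → a₁ < c → b₁ < c → a₂ < c → b₂ < c →
  WellFormed (tail a₁ b₁ a₂ b₂ c) c

module Binary (tail : Tail) (r₁ : Compiled) (r₂ : ℕ → Compiled) (c : ℕ) where
  c₁ = top (code r₁) c
  r₂′ = r₂ c₁
  c₂ = top (code r₂′) c₁
  rₜ = tail (pos r₁) (neg r₁) (pos r₂′) (neg r₂′) c₂

  combined : Compiled
  combined = compiled (code r₁ ++ code r₂′ ++ code rₜ) (pos rₜ) (neg rₜ)

  split : ∀ {ρ} → ρ ⊨* progEqs (code combined) c →
          ρ ⊨* progEqs (code r₁) c × ρ ⊨* progEqs (code r₂′) c₁ × ρ ⊨* progEqs (code rₜ) c₂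
  split ρ⊨ = map₂ (⊨*-++⁻ (code r₂′) (code rₜ) c₁) (⊨*-++⁻ (code r₁) _ c ρ⊨)

  denotes : ∀ _∙_ {ρ u v} → Implements tail _∙_ → AllPositive ρ → ρ ⊨* progEqs (code combined) c →
            (ρ ⊨* progEqs (code r₁) c → Denotes ρ r₁ u) →
            (ρ ⊨* progEqs (code r₂′) c₁ → Denotes ρ r₂′ v) →
            Denotes ρ combined (u ∙ v)
  denotes _∙_ implements ρ⁺ ρ⊨ denotes₁ denotes₂ with split ρ⊨
  ... | ρ⊨₁ , ρ⊨₂ , ρ⊨ₜ =
    trans (implements ρ⁺ ρ⊨ₜ) (cong₂ _∙_ (denotes₁ ρ⊨₁) (denotes₂ ρ⊨₂))

  wellFormed : ScopedTail tail → WellFormed r₁ c → WellFormed r₂′ c₁ → WellFormed combined c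
  wellFormed scoped (ws₁ , pos₁< , neg₁<) (ws₂ , pos₂< , neg₂<)
    with scoped (<-≤-trans pos₁< (c≤top (code r₂′) c₁)) (<-≤-trans neg₁< (c≤top (code r₂′) c₁))
                pos₂< neg₂<
  ... | wsₜ , posₜ< , negₜ< =
    WellScoped-++ (code r₁) _ c ws₁ (WellScoped-++ (code r₂′) (code rₜ) c₁ ws₂ wsₜ) ,
    subst (pos rₜ <_) (sym top≡) posₜ< , subst (neg rₜ <_) (sym top≡) negₜ<
    where
    top≡ : top (code combined) c ≡ top (code rₜ) c₂
    top≡ = trans (top-++ (code r₁) _ c) (top-++ (code r₂′) (code rₜ) c₁)

⊖≡- : ∀ m n → m ⊖ n ≡ + m ℤ.- + n
⊖≡- m n = sym (ℤ.[+m]-[+n]≡m⊖n m n)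

m⊖n≡0⇒m≡n : ∀ {m n} → m ⊖ n ≡ + 0 → m ≡ n
m⊖n≡0⇒m≡n {m} {n} m⊖n≡0 =
  ℤ.+-injective (ℤ.i-j≡0⇒i≡j (+ m) (+ n) (trans (sym (⊖≡- m n)) m⊖n≡0))

⊖-+ : ∀ a₁ b₁ a₂ b₂ → (a₁ + a₂) ⊖ (b₁ + b₂) ≡ (a₁ ⊖ b₁) ℤ.+ (a₂ ⊖ b₂)
⊖-+ a₁ b₁ a₂ b₂ = begin
  (a₁ + a₂) ⊖ (b₁ + b₂)                  ≡⟨ ⊖≡- (a₁ + a₂) (b₁ + b₂) ⟩
  + (a₁ + a₂) ℤ.- + (b₁ + b₂)            ≡⟨ cong₂ ℤ._-_ (ℤ.pos-+ a₁ a₂) (ℤ.pos-+ b₁ b₂) ⟩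
  (+ a₁ ℤ.+ + a₂) ℤ.- (+ b₁ ℤ.+ + b₂)    ≡⟨ rearrange (+ a₁) (+ b₁) (+ a₂) (+ b₂) ⟩
  (+ a₁ ℤ.- + b₁) ℤ.+ (+ a₂ ℤ.- + b₂)    ≡⟨ cong₂ ℤ._+_ (⊖≡- a₁ b₁) (⊖≡- a₂ b₂) ⟨
  (a₁ ⊖ b₁) ℤ.+ (a₂ ⊖ b₂)                ∎
  where
  open ≡-Reasoning
  rearrange : ∀ u₁ v₁ u₂ v₂ →
              (u₁ ℤ.+ u₂) ℤ.- (v₁ ℤ.+ v₂) ≡ (u₁ ℤ.- v₁) ℤ.+ (u₂ ℤ.- v₂)
  rearrange = ℤ-Ring.solve-∀

⊖-* : ∀ a₁ b₁ a₂ b₂ →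
      (a₁ * a₂ + b₁ * b₂) ⊖ (a₁ * b₂ + b₁ * a₂) ≡ (a₁ ⊖ b₁) ℤ.* (a₂ ⊖ b₂)
⊖-* a₁ b₁ a₂ b₂ = begin
  (a₁ * a₂ + b₁ * b₂) ⊖ (a₁ * b₂ + b₁ * a₂)
    ≡⟨ ⊖≡- (a₁ * a₂ + b₁ * b₂) (a₁ * b₂ + b₁ * a₂) ⟩
  + (a₁ * a₂ + b₁ * b₂) ℤ.- + (a₁ * b₂ + b₁ * a₂)
    ≡⟨ cong₂ ℤ._-_ (pos-+* a₁ a₂ b₁ b₂) (pos-+* a₁ b₂ b₁ a₂) ⟩
  (A₁ ℤ.* A₂ ℤ.+ B₁ ℤ.* B₂) ℤ.- (A₁ ℤ.* B₂ ℤ.+ B₁ ℤ.* A₂)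
    ≡⟨ factor A₁ B₁ A₂ B₂ ⟩
  (A₁ ℤ.- B₁) ℤ.* (A₂ ℤ.- B₂)
    ≡⟨ cong₂ ℤ._*_ (⊖≡- a₁ b₁) (⊖≡- a₂ b₂) ⟨
  (a₁ ⊖ b₁) ℤ.* (a₂ ⊖ b₂)
    ∎
  where
  open ≡-Reasoning
  A₁ = + a₁
  B₁ = + b₁
  A₂ = + a₂
  B₂ = + b₂
  pos-+* : ∀ w x y z → + (w * x + y * z) ≡ + w ℤ.* + x ℤ.+ + y ℤ.* + z
  pos-+* w x y z = trans (ℤ.pos-+ (w * x) (y * z)) (cong₂ ℤ._+_ (ℤ.pos-* w x) (ℤ.pos-* y z))
  factor : ∀ u₁ v₁ u₂ v₂ →
           (u₁ ℤ.* u₂ ℤ.+ v₁ ℤ.* v₂) ℤ.- (u₁ ℤ.* v₂ ℤ.+ v₁ ℤ.* u₂) ≡ (u₁ ℤ.- v₁) ℤ.* (u₂ ℤ.- v₂)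
  factor = ℤ-Ring.solve-∀

addI-sum : ∀ {ρ i j c} → AllPositive ρ → ρ ⊨* instrEqs (addI i j) c → ρ c ≡ ρ i + ρ j
addI-sum ρ⁺ ρ⊨ = sum-determined (ρ⁺ _) ρ⊨ 0 z<s

sumTail : Tail
sumTail a₁ b₁ a₂ b₂ c = compiled (addI a₁ a₂ ∷ addI b₁ b₂ ∷ []) c (10 + c)

sumTail-implements : Implements sumTail ℤ._+_
sumTail-implements {ρ} {a₁} {b₁} {a₂} {b₂} {c} ρ⁺ ρ⊨ =
  trans (cong₂ _⊖_ (addI-sum ρ⁺ ρ⊨₁) (addI-sum ρ⁺ ρ⊨₂)) (⊖-+ (ρ a₁) (ρ b₁) (ρ a₂) (ρ b₂))
  where
  ρ⊨₁ = All.++⁻ˡ (instrEqs (addI a₁ a₂) c) ρ⊨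
  ρ⊨₂ = All.++⁻ˡ (instrEqs (addI b₁ b₂) (10 + c)) (All.++⁻ʳ (instrEqs (addI a₁ a₂) c) ρ⊨)

sumTail-scoped : ScopedTail sumTail
sumTail-scoped {c = c} a₁< b₁< a₂< b₂< =
  ((a₁< , a₂<) , (m≤n⇒m≤o+n 10 b₁< , m≤n⇒m≤o+n 10 b₂<) , tt) , offset-< 0 20 c , offset-< 10 20 c

-- (a₁ − b₁)(a₂ − b₂) = (a₁ a₂ + b₁ b₂) − (a₁ b₂ + b₁ a₂)
productTail : Tail
productTail a₁ b₁ a₂ b₂ c =
  compiled (mulI a₁ a₂ ∷ mulI b₁ b₂ ∷ mulI a₁ b₂ ∷ mulI b₁ a₂ ∷ addI c (1 + c) ∷ addI (2 + c) (3 + c) ∷ [])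
           (4 + c) (14 + c)

productTail-implements : Implements productTail ℤ._*_
productTail-implements {ρ} {a₁} {b₁} {a₂} {b₂} {c} ρ⁺ (a₁a₂ ∷ b₁b₂ ∷ a₁b₂ ∷ b₁a₂ ∷ ρ⊨) =
  trans (cong₂ _⊖_ (trans (addI-sum ρ⁺ ρ⊨₁) (sym (cong₂ _+_ a₁a₂ b₁b₂)))
                   (trans (addI-sum ρ⁺ ρ⊨₂) (sym (cong₂ _+_ a₁b₂ b₁a₂))))
        (⊖-* (ρ a₁) (ρ b₁) (ρ a₂) (ρ b₂))
  where
  ρ⊨₁ = All.++⁻ˡ (instrEqs (addI c (1 + c)) (4 + c)) ρ⊨
  ρ⊨₂ = All.++⁻ˡ (instrEqs (addI (2 + c) (3 + c)) (14 + c))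
                 (All.++⁻ʳ (instrEqs (addI c (1 + c)) (4 + c)) ρ⊨)

productTail-scoped : ScopedTail productTail
productTail-scoped {c = c} a₁< b₁< a₂< b₂< =
  ( (a₁< , a₂<) , (up 1 b₁< , up 1 b₂<) , (up 2 a₁< , up 2 b₂<) , (up 3 b₁< , up 3 a₂<)
  , (offset-< 0 4 c , offset-< 1 4 c) , (offset-< 2 14 c , offset-< 3 14 c) , tt)
  , offset-< 4 24 c , offset-< 14 24 c
  where
  up : ∀ k {m} → m < c → m < k + c
  up k = m≤n⇒m≤o+n k

sucChain : ℕ → ℕ → ℕ → Program
sucChain zero    s c = []
sucChain (suc k) s c = sucI s ∷ sucChain k c (suc c)

sucChainEnd : ℕ → ℕ → ℕ → ℕ
sucChainEnd zero    s c = s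
sucChainEnd (suc k) s c = sucChainEnd k c (suc c)

sucChain-value : ∀ k s c {ρ} → ρ ⊨* progEqs (sucChain k s c) c → ρ (sucChainEnd k s c) ≡ ρ s + k
sucChain-value zero    s c     _        = sym (+-identityʳ _)
sucChain-value (suc k) s c {ρ} (e ∷ ρ⊨) =
  trans (sucChain-value k c (suc c) ρ⊨) (trans (cong (_+ k) (sym e)) (+-assoc (ρ s) 1 k))

sucChain-scoped : ∀ k s c → s < c →
                  WellScoped (sucChain k s c) c × sucChainEnd k s c < top (sucChain k s c) c
sucChain-scoped zero    s c s<c = tt , s<c
sucChain-scoped (suc k) s c s<c = map₁ (s<c ,_) (sucChain-scoped k c (suc c) (n<1+n c))

-- Cell o must hold 1 and cells from c on are free. Cells are positive, so x_i is represented
-- as (x_i + 1) ⊖ 1 and a constant k ≥ 0 as (1 + k) ⊖ 1.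
compile : ∀ {p} → Poly p → ℕ → ℕ → Compiled
compile (con (+ k))    o c = compiled (sucChain k o c) (sucChainEnd k o c) o
compile (con -[1+ k ]) o c = compiled (sucChain (suc k) o c) o (sucChainEnd (suc k) o c)
compile (var i)        o c = compiled (sucI (toℕ i) ∷ []) c o
compile (d ⊕ e)        o c = Binary.combined sumTail (compile d o c) (compile e o) c
compile (d ⊗ e)        o c = Binary.combined productTail (compile d o c) (compile e o) c

compile-denotes : ∀ {p} (t : Poly p) o c (x : Vec ℕ p) {ρ} → AllPositive ρ → ρ o ≡ 1 →
                  (∀ i → ρ (toℕ i) ≡ lookup x i) → ρ ⊨* progEqs (code (compile t o c)) c →
                  Denotes ρ (compile t o c) (eval t x)
compile-denotes (con (+ k))    o c x ρ⁺ o≡1 ρ≡x ρ⊨ =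
  cong₂ _⊖_ (trans (sucChain-value k o c ρ⊨) (cong (_+ k) o≡1)) o≡1
compile-denotes (con -[1+ k ]) o c x ρ⁺ o≡1 ρ≡x ρ⊨ =
  cong₂ _⊖_ o≡1 (trans (sucChain-value (suc k) o c ρ⊨) (cong (_+ suc k) o≡1))
compile-denotes (var i)        o c x ρ⁺ o≡1 ρ≡x (e ∷ []) =
  cong₂ _⊖_ (trans (sym e) (trans (cong (_+ 1) (ρ≡x i)) (+-comm _ 1))) o≡1
compile-denotes (d ⊕ e)        o c x ρ⁺ o≡1 ρ≡x ρ⊨ =
  Binary.denotes sumTail (compile d o c) (compile e o) c ℤ._+_ sumTail-implements ρ⁺ ρ⊨
    (compile-denotes d o c x ρ⁺ o≡1 ρ≡x) (compile-denotes e o _ x ρ⁺ o≡1 ρ≡x)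
compile-denotes (d ⊗ e)        o c x ρ⁺ o≡1 ρ≡x ρ⊨ =
  Binary.denotes productTail (compile d o c) (compile e o) c ℤ._*_ productTail-implements ρ⁺ ρ⊨
    (compile-denotes d o c x ρ⁺ o≡1 ρ≡x) (compile-denotes e o _ x ρ⁺ o≡1 ρ≡x)

compile-wellFormed : ∀ {p} (t : Poly p) o c → o < c → (∀ (i : Fin p) → toℕ i < c) →
                     WellFormed (compile t o c) c
compile-wellFormed (con (+ k))    o c o<c _ =
  map₂ (_, ≤-trans o<c (c≤top (sucChain k o c) c)) (sucChain-scoped k o c o<c)
compile-wellFormed (con -[1+ k ]) o c o<c _ =
  map₂ (≤-trans o<c (c≤top (sucChain (suc k) o c) c) ,_) (sucChain-scoped (suc k) o c o<c)
compile-wellFormed (var i)        o c o<c i<c = (i<c i , tt) , n<1+n c , m<n⇒m<1+n o<c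
compile-wellFormed (d ⊕ e)        o c o<c i<c =
  Binary.wellFormed sumTail (compile d o c) (compile e o) c sumTail-scoped
    (compile-wellFormed d o c o<c i<c)
    (compile-wellFormed e o _ (<-≤-trans o<c c≤c₁) (λ i → <-≤-trans (i<c i) c≤c₁))
  where c≤c₁ = c≤top (code (compile d o c)) c
compile-wellFormed (d ⊗ e)        o c o<c i<c =
  Binary.wellFormed productTail (compile d o c) (compile e o) c productTail-scoped
    (compile-wellFormed d o c o<c i<c)
    (compile-wellFormed e o _ (<-≤-trans o<c c≤c₁) (λ i → <-≤-trans (i<c i) c≤c₁))
  where c≤c₁ = c≤top (code (compile d o c)) c

-- From cells to systems of E_N

replicate-oneI-scoped : ∀ k c → WellScoped (replicate k oneI) c
replicate-oneI-scoped zero    c = tt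
replicate-oneI-scoped (suc k) c = tt , replicate-oneI-scoped k (suc c)

top-replicate-oneI : ∀ k c → top (replicate k oneI) c ≡ k + c
top-replicate-oneI zero    c = refl
top-replicate-oneI (suc k) c = trans (top-replicate-oneI k (suc c)) (+-suc k c)

opaque
  fromℕ-or : ∀ {N} → Fin N → ℕ → Fin N
  fromℕ-or {N} d m with m <? N
  ... | yes m<N = fromℕ< m<N
  ... | no  _   = d

  fromℕ-or-toℕ : ∀ {N} (d : Fin N) i → fromℕ-or d (toℕ i) ≡ i
  fromℕ-or-toℕ {N} d i with toℕ i <? N
  ... | yes i<N = Fin.fromℕ<-toℕ i i<N
  ... | no  i≮N = contradiction (Fin.toℕ<n i) i≮N

  toℕ-fromℕ-or : ∀ {N} (d : Fin N) {m} → m < N → toℕ (fromℕ-or d m) ≡ m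
  toℕ-fromℕ-or {N} d {m} m<N with m <? N
  ... | yes _   = Fin.toℕ-fromℕ< m<N
  ... | no  m≮N = contradiction m<N m≮N

-- Indices out of range are sent to d; they never occur in the equations translated below.
toEqn : ∀ {N} → Fin N → Equation → Eqn N
toEqn d (mulE i j k) = mulEq (fromℕ-or d i) (fromℕ-or d j) (fromℕ-or d k)
toEqn d (sucE i k)   = sucEq (fromℕ-or d i) (fromℕ-or d k)

asAssignment : ∀ {N} → Fin N → Vec ℕ N → Assignment
asAssignment d y m = lookup y (fromℕ-or d m)

⊨⇒Holds : ∀ {N} (d : Fin N) y e → asAssignment d y ⊨ e → Holds y (toEqn d e)
⊨⇒Holds d y (mulE _ _ _) y⊨e = y⊨e
⊨⇒Holds d y (sucE _ _)   y⊨e = y⊨e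

Holds⇒⊨ : ∀ {N} (d : Fin N) y e → Holds y (toEqn d e) → asAssignment d y ⊨ e
Holds⇒⊨ d y (mulE _ _ _) y⊨e = y⊨e
Holds⇒⊨ d y (sucE _ _)   y⊨e = y⊨e

asAssignment-positive : ∀ {N} (d : Fin N) {y} → Positive y → AllPositive (asAssignment d y)
asAssignment-positive d y⁺ m = VecAll.lookup⁺ y⁺ (fromℕ-or d m)

asAssignment-tabulate : ∀ {N} (d : Fin N) σ → asAssignment d (tabulate (σ ∘ toℕ)) ≈[ N ] σ
asAssignment-tabulate d σ m m<N =
  trans (Vec.lookup∘tabulate (σ ∘ toℕ) (fromℕ-or d m)) (cong σ (toℕ-fromℕ-or d m<N))

≈⇒≡tabulate : ∀ {N} (d : Fin N) y σ → asAssignment d y ≈[ N ] σ → y ≡ tabulate (σ ∘ toℕ)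
≈⇒≡tabulate d y σ y≈σ = trans (sym (Vec.tabulate∘lookup y)) (Vec.tabulate-cong λ i →
  trans (cong (lookup y) (sym (fromℕ-or-toℕ d i))) (y≈σ (toℕ i) (Fin.toℕ<n i)))

tabulate-positive : ∀ {n} {σ} → AllPositive σ → Positive (tabulate {n = n} (σ ∘ toℕ))
tabulate-positive σ⁺ = VecAll.tabulate⁺ (σ⁺ ∘ toℕ)

opaque
  inputs : ∀ {p} → Vec ℕ p → Assignment
  inputs {p} x m with m <? p
  ... | yes m<p = lookup x (fromℕ< m<p)
  ... | no  _   = 1

  inputs-lookup : ∀ {p} (x : Vec ℕ p) i → inputs x (toℕ i) ≡ lookup x i
  inputs-lookup {p} x i with toℕ i <? p
  ... | yes i<p = cong (lookup x) (Fin.fromℕ<-toℕ i i<p)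
  ... | no  i≮p = contradiction (Fin.toℕ<n i) i≮p

  inputs-positive : ∀ {p} {x : Vec ℕ p} → Positive x → AllPositive (inputs x)
  inputs-positive {p} x⁺ m with m <? p
  ... | yes m<p = VecAll.lookup⁺ x⁺ (fromℕ< m<p)
  ... | no  _   = s≤s z≤n

  inputs-tabulate : ∀ {p} σ → inputs (tabulate {n = p} (σ ∘ toℕ)) ≈[ p ] σ
  inputs-tabulate {p} σ m m<p with m <? p
  ... | yes _   = trans (Vec.lookup∘tabulate (σ ∘ toℕ) (fromℕ< m<p)) (cong σ (Fin.toℕ-fromℕ< m<p))
  ... | no  m≮p = contradiction m<p m≮p

-- Cells 0, …, p − 1 hold x and cell p holds 1; D is compiled from cell p + 1 on and is followed
-- by δ padding cells equal to 1, so that δ ≤ size; the last equation pos · 1 = neg says D(x) = 0.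
module Simulation {p} (D : Poly p) (δ : ℕ) where
  r : Compiled
  r = compile D p (suc p)

  program : Program
  program = oneI ∷ code r ++ replicate δ oneI

  size : ℕ
  size = top program p

  equations : List Equation
  equations = progEqs program p ++ mulE (pos r) p (neg r) ∷ []

  r-wellFormed : WellFormed r (suc p)
  r-wellFormed = compile-wellFormed D p (suc p) (n<1+n p) (λ i → m<n⇒m<1+n (Fin.toℕ<n i))

  program-scoped : WellScoped program p
  program-scoped = tt , WellScoped-++ (code r) _ (suc p) (proj₁ r-wellFormed) (replicate-oneI-scoped δ _)

  top-r≤size : top (code r) (suc p) ≤ size
  top-r≤size = subst (top (code r) (suc p) ≤_) (sym (top-++ (code r) (replicate δ oneI) (suc p)))
                     (c≤top (replicate δ oneI) _)

  δ≤size : δ ≤ size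
  δ≤size = subst (δ ≤_) (sym (trans (top-++ (code r) (replicate δ oneI) (suc p)) (top-replicate-oneI δ _)))
                 (m≤m+n δ _)

  p<size : p < size
  p<size = <-≤-trans (n<1+n p) (≤-trans (c≤top (code r) (suc p)) top-r≤size)

  equations-below : All.All (VarsBelow size) equations
  equations-below = All.++⁺ (progEqs-below program p program-scoped)
    ((<-≤-trans (proj₁ (proj₂ r-wellFormed)) top-r≤size , p<size ,
      <-≤-trans (proj₂ (proj₂ r-wellFormed)) top-r≤size) ∷ [])

  d : Fin size
  d = fromℕ< p<size

  system : System size
  system = map (toEqn d) equations

  solves⇒⊨ : ∀ {y} → All.All (Holds y) system → asAssignment d y ⊨* equations
  solves⇒⊨ {y} y⊨ = All.map (λ {e} → Holds⇒⊨ d y e) (All.map⁻ y⊨)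

  ⊨⇒solves : ∀ {y} → asAssignment d y ⊨* equations → All.All (Holds y) system
  ⊨⇒solves {y} y⊨ = All.map⁺ (All.map (λ {e} → ⊨⇒Holds d y e) y⊨)

  program-denotes : ∀ {ρ} x → AllPositive ρ → (∀ i → ρ (toℕ i) ≡ lookup x i) → ρ ⊨* progEqs program p →
                    ρ p ≡ 1 × Denotes ρ r (eval D x)
  program-denotes x ρ⁺ ρ≡x (one ∷ ρ⊨) =
    p≡1 , compile-denotes D p (suc p) x ρ⁺ p≡1 ρ≡x
            (proj₁ (⊨*-++⁻ (code r) (replicate δ oneI) (suc p) ρ⊨))
    where p≡1 = m*m≡m⇒m≡1 _ (ρ⁺ p) one

  restrict : Vec ℕ size → Vec ℕ p
  restrict y = tabulate (asAssignment d y ∘ toℕ)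

  extend : Vec ℕ p → Vec ℕ size
  extend x = tabulate (run program p (inputs x) ∘ toℕ)

  restrict-sound : ∀ y → SolvesSys system y → SolvesD D (restrict y)
  restrict-sound y (y⁺ , y⊨) = tabulate-positive ρ⁺ , (begin
    eval D (restrict y)     ≡⟨ proj₂ denotes ⟨
    ρ (pos r) ⊖ ρ (neg r)   ≡⟨ cong (_⊖ ρ (neg r)) pos≡neg ⟩
    ρ (neg r) ⊖ ρ (neg r)   ≡⟨ ℤ.n⊖n≡0 (ρ (neg r)) ⟩
    + 0                     ∎)
    where
    open ≡-Reasoning
    ρ = asAssignment d y
    ρ⁺ = asAssignment-positive d y⁺
    ρ⊨ = solves⇒⊨ y⊨
    denotes = program-denotes (restrict y) ρ⁺ (λ i → sym (Vec.lookup∘tabulate _ i))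
                              (All.++⁻ˡ (progEqs program p) ρ⊨)
    pos≡neg : ρ (pos r) ≡ ρ (neg r)
    pos≡neg = trans (sym (*-identityʳ _))
                    (trans (cong (ρ (pos r) *_) (sym (proj₁ denotes)))
                           (All.head (All.++⁻ʳ (progEqs program p) ρ⊨)))

  extend-complete : ∀ x → SolvesD D x → SolvesSys system (extend x)
  extend-complete x (x⁺ , D≡0) =
    tabulate-positive σ⁺ ,
    ⊨⇒solves (⊨*-resp-≈ (λ m m<N → sym (asAssignment-tabulate d σ m m<N)) equations-below σ⊨)
    where
    σ = run program p (inputs x)
    σ⁺ = run-positive program p (inputs-positive x⁺)
    σ⊨program = run-⊨ program p (inputs x) program-scoped
    denotes = program-denotes x σ⁺
      (λ i → trans (run-≈ program p _ (toℕ i) (Fin.toℕ<n i)) (inputs-lookup x i)) σ⊨program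
    σ⊨ : σ ⊨* equations
    σ⊨ = All.++⁺ σ⊨program
      (trans (cong (σ (pos r) *_) (proj₁ denotes))
             (trans (*-identityʳ _) (m⊖n≡0⇒m≡n (trans (proj₂ denotes) D≡0))) ∷ [])

  determined : ∀ y → SolvesSys system y → y ≡ extend (restrict y)
  determined y (y⁺ , y⊨) =
    ≈⇒≡tabulate d y σ (progEqs-determine program p ρ⁺ σ⁺ program-scoped ρ⊨ σ⊨ ρ≈σ)
    where
    ρ = asAssignment d y
    ρ⁺ = asAssignment-positive d y⁺
    ρ⊨ = All.++⁻ˡ (progEqs program p) (solves⇒⊨ y⊨)
    σ = run program p (inputs (restrict y))
    σ⁺ = run-positive program p (inputs-positive (tabulate-positive ρ⁺))
    σ⊨ = run-⊨ program p (inputs (restrict y)) program-scoped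
    ρ≈σ : ρ ≈[ p ] σ
    ρ≈σ m m<p = sym (trans (run-≈ program p _ m m<p) (inputs-tabulate ρ m m<p))

  solvable⇔ : (∃ λ y → SolvesSys system y) ⇔ (∃ λ x → SolvesD D x)
  solvable⇔ = mk⇔ (λ (y , sol) → restrict y , restrict-sound y sol)
                  (λ (x , sol) → extend x , extend-complete x sol)

  finitelyMany : FinitelyManyD D → FinitelyManySys system
  finitelyMany (xs , complete) = map extend xs , λ y sol →
    subst (_∈ map extend xs) (sym (determined y sol))
          (∈-map⁺ extend (complete (restrict y) (restrict-sound y sol)))

-- Bounded search

∃≤? : ∀ {P : ℕ → Set} → Decidable P → ∀ b → Dec (∃ λ v → v ≤ b × P v)
∃≤? P? b = Dec.map′ (λ (v , v<1+b , Pv) → v , s≤s⁻¹ v<1+b , Pv)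
                    (λ (v , v≤b , Pv) → v , s≤s v≤b , Pv)
                    (anyUpTo? P? (suc b))

∃-boundedVec? : ∀ n b {P : Vec ℕ n → Set} → Decidable P → Dec (∃ λ x → VecAll.All (_≤ b) x × P x)
∃-boundedVec? zero    b P? = Dec.map′ (λ Pv → [] , [] , Pv) (λ { ([] , [] , Pv) → Pv }) (P? [])
∃-boundedVec? (suc n) b P? =
  Dec.map′ (λ (v , v≤b , xs , xs≤b , Pv) → v ∷ xs , v≤b ∷ xs≤b , Pv)
           (λ { (v ∷ xs , v≤b ∷ xs≤b , Pv) → v , v≤b , xs , xs≤b , Pv })
           (∃≤? (λ v → ∃-boundedVec? n b (λ xs → P? (v ∷ xs))) b)

holds? : ∀ {n} (y : Vec ℕ n) → Decidable (Holds y)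
holds? y (mulEq i j k) = lookup y i * lookup y j ≟ lookup y k
holds? y (sucEq i k)   = lookup y i + 1 ≟ lookup y k

solvesSys? : ∀ {n} (S : System n) → Decidable (SolvesSys S)
solvesSys? S y = VecAll.all? (1 ≤?_) y ×-dec All.all? (holds? y) S

BoundedSolution : ∀ {n} → System n → ℕ → Set
BoundedSolution S b = ∃ λ y → VecAll.All (_≤ b) y × SolvesSys S y

boundedSolution? : ∀ {n} (S : System n) b → Dec (BoundedSolution S b)
boundedSolution? {n} S b = ∃-boundedVec? n b (solvesSys? S)

boundedSolution⇔solution : ∀ {n b} {S : System n} → ThetaProp n b → FinitelyManySys S →
                           BoundedSolution S b ⇔ (∃ λ y → SolvesSys S y)
boundedSolution⇔solution θ finite = mk⇔ (map₂ proj₂) (λ solvable → map₂ swap (θ _ solvable finite))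

θ-property : ∀ {n B} → ThetaLeq n B → ∃ (ThetaProp n)
θ-property (b , (_ , θ , _) , _) = b , θ

does≡true⇔ : ∀ {A : Set} (a? : Dec A) → (does a? ≡ true) ⇔ A
does≡true⇔ (yes a)  = mk⇔ (λ _ → a) (λ _ → refl)
does≡true⇔ (no ¬a) = mk⇔ (λ ()) (λ a → contradiction a ¬a)

-- Only the existence of θ(N) for all large N is used: neither its bound nor δ ≥ 9 plays a role.
theorem4 :
    (∃ λ δ → 9 ≤ δ × (∀ n → δ ≤ n → ThetaLeq n (bound n))) →
    Σ ((p : ℕ) → Poly p → Bool) λ alg →
      ∀ (p : ℕ) (D : Poly p) → FinitelyManyD D →
        (alg p D ≡ true ⇔ ∃ λ x → SolvesD D x)
theorem4 (δ , _ , θ≤bound) = (λ p D → does (search D)) , correct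
  where
  θ : ∀ {p} (D : Poly p) → ∃ (ThetaProp (Simulation.size D δ))
  θ D = θ-property (θ≤bound _ (Simulation.δ≤size D δ))
  search : ∀ {p} (D : Poly p) → Dec (BoundedSolution (Simulation.system D δ) (proj₁ (θ D)))
  search D = boundedSolution? (Simulation.system D δ) (proj₁ (θ D))
  correct : ∀ p (D : Poly p) → FinitelyManyD D → (does (search D) ≡ true ⇔ ∃ λ x → SolvesD D x)
  correct p D finite =
    ⇔.trans (does≡true⇔ (search D))
      (⇔.trans (boundedSolution⇔solution (proj₂ (θ D)) (Simulation.finitelyMany D δ finite))
               (Simulation.solvable⇔ D δ))
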